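{- Let $\mathbb{P}$ be a class of predicates and let $P$ be an $\mathbf{FBI}^{\mathbb{P}}$-proof of a safety problem $\Pi$. Then $\operatorname{Inv}^\rightleftharpoons(P)$ is a safe inductive invariant of $\Pi$, and if $P$ contains $n\in\mathbb{N}$ instances of the rule (Ind), then $\operatorname{Inv}^\rightleftharpoons(P)$ is a Boolean combination of $n$ predicates from $\mathbb{P}$.
   Context: Let $\Sigma$ be a first-order vocabulary and $\Sigma'$ its primed copy; $\varphi'$ denotes $\varphi$ with every symbol primed. A safety problem is a triple $(\iota,\tau,\beta)$ of closed formulas, $\iota,\beta$ over $\Sigma$ and $\tau$ over $\Sigma\cup\Sigma'$. $\tau^{ -1}$ is obtained from $\tau$ by swapping each symbol of $\Sigma$ with its primed counterpart. $A\Rightarrow B$ denotes validity of $A\to B$. A closed formula $\varphi$ over $\Sigma$ is a safe inductive invariant of $(\iota,\tau,\beta)$ if $\iota\Rightarrow\varphi$, $\varphi\wedge\tau\Rightarrow\varphi'$ and $\varphi\Rightarrow\neg\beta$. The proof system $\mathbf{FBI}$ has rules: (Ind): with no premises, conclude $(\iota,\tau,\neg\varphi)$ provided $\iota\Rightarrow\varphi$ and $\varphi\wedge\tau\Rightarrow\varphi'$; (Cons): from $(\iota,\tau,\neg\varphi)$ conclude $(\iota,\tau,\beta)$ provided $\varphi\Rightarrow\neg\beta$; (Inc): from premises $(\iota,\tau,\neg\varphi)$ and $(\iota\wedge\varphi,\tau\wedge\varphi\wedge\varphi',\beta\wedge\varphi)$ conclude $(\iota,\tau,\beta)$; (Rev):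 from $(\beta,\tau^{ -1},\iota)$ conclude $(\iota,\tau,\beta)$. A proof is a finite tree of safety problems, each node the conclusion of a rule applied to its children. $\mathbf{FBI}^{\mathbb{P}}$ restricts every application of (Ind) to $\varphi\in\mathbb{P}$. $\operatorname{Inv}^\rightleftharpoons(P)$ is defined by induction on $P$: if the root is a conclusion $(\iota,\tau,\neg\varphi)$ of (Ind), it is $\varphi$; if the root is a conclusion of (Cons) with premise proof $\tilde P$, it is $\operatorname{Inv}^\rightleftharpoons(\tilde P)$; if the root is a conclusion of (Inc) with premise proofs $P_1,P_2$, it is $\operatorname{Inv}^\rightleftharpoons(P_1)\wedge\operatorname{Inv}^\rightleftharpoons(P_2)$; if the root is a conclusion of (Rev) with premise proof $\tilde P$, it is $\neg\operatorname{Inv}^\rightleftharpoons(\tilde P)$. -}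

module Defs where

open import Data.Nat using (ℕ; zero; suc; _+_)
open import Data.Fin using (Fin)
import Data.Fin as F
open import Data.Vec using (Vec; []; _∷_)
import Data.Vec
open import Data.Bool using (Bool; T)
open import Data.Unit using (⊤; tt)
open import Data.Product using (_×_; Σ; ∃; _,_)
open import Data.Empty using (⊥)

import Data.Vec.Relation.Unary.All as VAll
open import Relation.Nullary using (¬_)
open import Relation.Binary.Definitions using (DecidableEquality)
open import Relation.Binary.PropositionalEquality using (_≡_)

-- Formulas are parametrised by a set I of "copies" of the vocabulary:
-- every symbol occurrence is tagged with a copy i : I.
--   * formulas over Σ         : I = ⊤
--   * formulas over Σ ∪ Σ'     : I = Copy  (cur = unprimed, nxt = primed)

record Vocabulary : Set₁ where
  field
    Fun      : Set
    Rel      : Set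
    funArity : Fun → ℕ
    relArity : Rel → ℕ

data Copy : Set where
  cur nxt : Copy

swapCopy : Copy → Copy
swapCopy cur = nxt
swapCopy nxt = cur

module _ (V : Vocabulary) where
  open Vocabulary V

  data Term (I : Set) (n : ℕ) : Set where
    var : Fin n → Term I n
    app : (i : I) (f : Fun) → Vec (Term I n) (funArity f) → Term I n

  infixr 6 _∧'_
  data Formula (I : Set) (n : ℕ) : Set where
    rel   : (i : I) (r : Rel) → Vec (Term I n) (relArity r) → Formula I n
    _≐_   : Term I n → Term I n → Formula I n
    ¬'_   : Formula I n → Formula I n
    _∧'_  : Formula I n → Formula I n → Formula I n
    ∀'_   : Formula I (suc n) → Formula I n

  Sentence : Set → Set
  Sentence I = Formula I 0

  _⟶_ : ∀ {I n} → Formula I n → Formula I n → Formula I n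
  A ⟶ B = ¬' (A ∧' ¬' B)

  mutual
    mapTerm : ∀ {I J n} → (I → J) → Term I n → Term J n
    mapTerm g (var x)      = var x
    mapTerm g (app i f ts) = app (g i) f (mapTerms g ts)

    mapTerms : ∀ {I J n k} → (I → J) → Vec (Term I n) k → Vec (Term J n) k
    mapTerms g []       = []
    mapTerms g (t ∷ ts) = mapTerm g t ∷ mapTerms g ts

  mapFormula : ∀ {I J n} → (I → J) → Formula I n → Formula J n
  mapFormula g (rel i r ts) = rel (g i) r (mapTerms g ts)
  mapFormula g (a ≐ b)      = mapTerm g a ≐ mapTerm g b
  mapFormula g (¬' φ)       = ¬' mapFormula g φ
  mapFormula g (φ ∧' ψ)     = mapFormula g φ ∧' mapFormula g ψ
  mapFormula g (∀' φ)       = ∀' mapFormula g φ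

  unprimed : ∀ {n} → Formula ⊤ n → Formula Copy n
  unprimed = mapFormula (λ _ → cur)

  primed : ∀ {n} → Formula ⊤ n → Formula Copy n
  primed = mapFormula (λ _ → nxt)

  inverse : ∀ {n} → Formula Copy n → Formula Copy n
  inverse = mapFormula swapCopy

  -- Structures have a nonempty domain; relations are
  -- Bool-valued (characteristic functions) and the domain has decidable
  -- equality, so satisfaction is ¬¬-stable and validity is classical
  -- first-order validity.
  record Structure (I : Set) : Set₁ where
    field
      Dom   : Set
      point : Dom
      _≟D_  : DecidableEquality Dom
      funI  : I → (f : Fun) → Vec Dom (funArity f) → Dom
      relI  : I → (r : Rel) → Vec Dom (relArity r) → Bool

  module _ {I : Set} (M : Structure I) where
    open Structure M

    extend : ∀ {n} → Dom → (Fin n → Dom) → Fin (suc n) → Dom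
    extend d ρ F.zero    = d
    extend d ρ (F.suc x) = ρ x

    mutual
      evalTerm : ∀ {n} → (Fin n → Dom) → Term I n → Dom
      evalTerm ρ (var x)      = ρ x
      evalTerm ρ (app i f ts) = funI i f (evalTerms ρ ts)

      evalTerms : ∀ {n k} → (Fin n → Dom) → Vec (Term I n) k → Vec Dom k
      evalTerms ρ []       = []
      evalTerms ρ (t ∷ ts) = evalTerm ρ t ∷ evalTerms ρ ts

    Sat : ∀ {n} → (Fin n → Dom) → Formula I n → Set
    Sat ρ (rel i r ts) = T (relI i r (evalTerms ρ ts))
    Sat ρ (a ≐ b)      = evalTerm ρ a ≡ evalTerm ρ b
    Sat ρ (¬' φ)       = ¬ Sat ρ φ
    Sat ρ (φ ∧' ψ)     = Sat ρ φ × Sat ρ ψ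
    Sat ρ (∀' φ)       = (d : Dom) → Sat (extend d ρ) φ

    emptyEnv : Fin 0 → Dom
    emptyEnv ()

  Valid : ∀ {I} → Sentence I → Set₁
  Valid {I} φ = (M : Structure I) → Sat M (emptyEnv M) φ

  _⇒_ : ∀ {I} → Sentence I → Sentence I → Set₁
  A ⇒ B = Valid (A ⟶ B)

  record SafetyProblem : Set where
    constructor ⟨_,_,_⟩
    field
      init  : Sentence ⊤
      trans : Sentence Copy
      bad   : Sentence ⊤

  SafeInductiveInvariant : SafetyProblem → Sentence ⊤ → Set₁
  SafeInductiveInvariant ⟨ ι , τ , β ⟩ φ =
    (ι ⇒ φ) × ((unprimed φ ∧' τ) ⇒ primed φ) × (φ ⇒ (¬' β))

  data FBI (ℙ : Sentence ⊤ → Set) : SafetyProblem → Set₁ where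
    Ind  : ∀ {ι τ φ} → ℙ φ → ι ⇒ φ → (unprimed φ ∧' τ) ⇒ primed φ →
           FBI ℙ ⟨ ι , τ , ¬' φ ⟩
    Cons : ∀ {ι τ β φ} → FBI ℙ ⟨ ι , τ , ¬' φ ⟩ → φ ⇒ (¬' β) →
           FBI ℙ ⟨ ι , τ , β ⟩
    Inc  : ∀ {ι τ β φ} → FBI ℙ ⟨ ι , τ , ¬' φ ⟩ →
           FBI ℙ ⟨ ι ∧' φ , τ ∧' unprimed φ ∧' primed φ , β ∧' φ ⟩ →
           FBI ℙ ⟨ ι , τ , β ⟩
    Rev  : ∀ {ι τ β} → FBI ℙ ⟨ β , inverse τ , ι ⟩ → FBI ℙ ⟨ ι , τ , β ⟩

  Inv⇄ : ∀ {ℙ Π} → FBI ℙ Π → Sentence ⊤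
  Inv⇄ (Ind {φ = φ} _ _ _) = φ
  Inv⇄ (Cons P _)          = Inv⇄ P
  Inv⇄ (Inc P₁ P₂)         = Inv⇄ P₁ ∧' Inv⇄ P₂
  Inv⇄ (Rev P)             = ¬' Inv⇄ P

  #Ind : ∀ {ℙ Π} → FBI ℙ Π → ℕ
  #Ind (Ind _ _ _)  = 1
  #Ind (Cons P _)   = #Ind P
  #Ind (Inc P₁ P₂)  = #Ind P₁ + #Ind P₂
  #Ind (Rev P)      = #Ind P

  data BoolExpr (n : ℕ) : Set where
    atom : Fin n → BoolExpr n
    neg  : BoolExpr n → BoolExpr n
    conj : BoolExpr n → BoolExpr n → BoolExpr n

  instantiate : ∀ {n} → BoolExpr n → Vec (Sentence ⊤) n → Sentence ⊤
  instantiate (atom x)   ps = Data.Vec.lookup ps x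
  instantiate (neg b)    ps = ¬' instantiate b ps
  instantiate (conj b c) ps = instantiate b ps ∧' instantiate c ps

  BoolCombinationOf : (Sentence ⊤ → Set) → ℕ → Sentence ⊤ → Set
  BoolCombinationOf ℙ n φ =
    Σ (BoolExpr n) λ b → Σ (Vec (Sentence ⊤) n) λ ps →
      VAll.All ℙ ps × instantiate b ps ≡ φ

{-# OPTIONS --safe #-}
-- Each rule preserves safe inductive invariants; (Ind) and (Cons) trivially. For (Inc),
-- the first invariant a implies φ in every state, so transitions of τ between
-- states of a are transitions of τ ∧ φ ∧ φ', and the conjunction a ∧ b is inductive.
-- For (Rev), a τ-step from ¬c to c would be a τ⁻¹-step from c to ¬c, so the
-- complement of an invariant of the reversed problem is inductive for τ; its
-- initial and bad conditions swap roles. Since Inv⇄ is built from the formulas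
-- of the (Ind) leaves by ∧ and ¬ alone, it is a Boolean combination of them.
module Submission where

open import Defs
open import Data.Unit using (⊤; tt)
open import Data.Bool using (true; false; T)
open import Data.Empty using (⊥-elim)
open import Data.Nat using (_+_)
open import Data.Fin using (Fin; _↑ˡ_; _↑ʳ_)
import Data.Fin as F
open import Data.Vec using (Vec; []; _∷_; _++_; lookup)
open import Data.Vec.Properties using (lookup-++ˡ; lookup-++ʳ)
import Data.Vec.Relation.Unary.All as VAll
open import Data.Vec.Relation.Unary.All.Properties using (++⁺)
open import Data.Product using (_×_; _,_)
open import Data.Product.Function.NonDependent.Propositional using (_×-⇔_)
open import Function using (id)
open import Function.Bundles using (_⇔_; mk⇔; Equivalence)
open import Function.Related.TypeIsomorphisms using (¬-cong-⇔)
open import Relation.Nullary using (¬_; yes; no)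
open import Relation.Binary.PropositionalEquality
  using (_≡_; _≗_; refl; trans; cong; cong₂; subst; subst₂; sym)

open Equivalence using (to; from)

module _ (V : Vocabulary) where
  open Structure

  _⊨_ : ∀ {I} → Structure V I → Sentence V I → Set
  M ⊨ φ = Sat V M (emptyEnv V M) φ

  Sat-stable : ∀ {I n} (M : Structure V I) (ρ : Fin n → Dom M) (φ : Formula V I n) →
    ¬ ¬ Sat V M ρ φ → Sat V M ρ φ
  Sat-stable M ρ (rel i r ts) ¬¬s with relI M i r (evalTerms V M ρ ts)
  ... | true  = tt
  ... | false = ⊥-elim (¬¬s id)
  Sat-stable M ρ (a ≐ b) ¬¬s with _≟D_ M (evalTerm V M ρ a) (evalTerm V M ρ b)
  ... | yes a≡b = a≡b
  ... | no  a≢b = ⊥-elim (¬¬s a≢b)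
  Sat-stable M ρ (¬' φ) ¬¬¬s s = ¬¬¬s (λ ¬s → ¬s s)
  Sat-stable M ρ (φ ∧' ψ) ¬¬s =
    Sat-stable M ρ φ (λ ¬a → ¬¬s (λ (a , _) → ¬a a)) ,
    Sat-stable M ρ ψ (λ ¬b → ¬¬s (λ (_ , b) → ¬b b))
  Sat-stable M ρ (∀' φ) ¬¬s d =
    Sat-stable M (extend V M d ρ) φ (λ ¬s → ¬¬s (λ s → ¬s (s d)))

  ⇒-elim : ∀ {I} (A B : Sentence V I) → _⇒_ V A B → ∀ M → M ⊨ A → M ⊨ B
  ⇒-elim A B A⇒B M a = Sat-stable M (emptyEnv V M) B (λ ¬b → A⇒B M (a , ¬b))

  ⇒-intro : ∀ {I} (A B : Sentence V I) → (∀ M → M ⊨ A → M ⊨ B) → _⇒_ V A B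
  ⇒-intro A B f M (a , ¬b) = ¬b (f M a)

  ⇒-¬¬-elim : ∀ {I} (A B : Sentence V I) → _⇒_ V A (¬' ¬' B) → _⇒_ V A B
  ⇒-¬¬-elim A B A⇒¬¬B = ⇒-intro A B λ M a →
    Sat-stable M (emptyEnv V M) B (⇒-elim A (¬' ¬' B) A⇒¬¬B M a)

  reduct : ∀ {I J} → (I → J) → Structure V J → Structure V I
  reduct g M = record
    { Dom = Dom M ; point = point M ; _≟D_ = _≟D_ M
    ; funI = λ i → funI M (g i) ; relI = λ i → relI M (g i) }

  module _ {I J : Set} (g : I → J) (M : Structure V J) where

    mutual
      evalTerm-reduct : ∀ {n} {ρ ρ' : Fin n → Dom M} → ρ ≗ ρ' → (t : Term V I n) →
        evalTerm V (reduct g M) ρ t ≡ evalTerm V M ρ' (mapTerm V g t)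
      evalTerm-reduct ρ≗ρ' (var x)      = ρ≗ρ' x
      evalTerm-reduct ρ≗ρ' (app i f ts) = cong (funI M (g i) f) (evalTerms-reduct ρ≗ρ' ts)

      evalTerms-reduct : ∀ {n k} {ρ ρ' : Fin n → Dom M} → ρ ≗ ρ' → (ts : Vec (Term V I n) k) →
        evalTerms V (reduct g M) ρ ts ≡ evalTerms V M ρ' (mapTerms V g ts)
      evalTerms-reduct ρ≗ρ' []       = refl
      evalTerms-reduct ρ≗ρ' (t ∷ ts) =
        cong₂ _∷_ (evalTerm-reduct ρ≗ρ' t) (evalTerms-reduct ρ≗ρ' ts)

    extend-reduct : ∀ {n} {ρ ρ' : Fin n → Dom M} → ρ ≗ ρ' → ∀ d →
      extend V (reduct g M) d ρ ≗ extend V M d ρ'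
    extend-reduct ρ≗ρ' d F.zero    = refl
    extend-reduct ρ≗ρ' d (F.suc x) = ρ≗ρ' x

    -- extend for reduct g M and for M are distinct functions, so environments are compared pointwise.
    Sat-reduct : ∀ {n} {ρ ρ' : Fin n → Dom M} → ρ ≗ ρ' → (φ : Formula V I n) →
      Sat V (reduct g M) ρ φ ⇔ Sat V M ρ' (mapFormula V g φ)
    Sat-reduct ρ≗ρ' (rel i r ts) = mk⇔ (subst (λ v → T (relI M (g i) r v)) ts≡)
                                        (subst (λ v → T (relI M (g i) r v)) (sym ts≡))
      where ts≡ = evalTerms-reduct ρ≗ρ' ts
    Sat-reduct ρ≗ρ' (a ≐ b) = mk⇔ (subst₂ _≡_ a≡ b≡) (subst₂ _≡_ (sym a≡) (sym b≡))
      where a≡ = evalTerm-reduct ρ≗ρ' a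
            b≡ = evalTerm-reduct ρ≗ρ' b
    Sat-reduct ρ≗ρ' (¬' φ)   = ¬-cong-⇔ (Sat-reduct ρ≗ρ' φ)
    Sat-reduct ρ≗ρ' (φ ∧' ψ) = Sat-reduct ρ≗ρ' φ ×-⇔ Sat-reduct ρ≗ρ' ψ
    Sat-reduct ρ≗ρ' (∀' φ)   = mk⇔ (λ s d → to   (Sat-reduct (extend-reduct ρ≗ρ' d) φ) (s d))
                                   (λ s d → from (Sat-reduct (extend-reduct ρ≗ρ' d) φ) (s d))

    ⊨-mapFormula : (φ : Sentence V I) → reduct g M ⊨ φ ⇔ M ⊨ mapFormula V g φ
    ⊨-mapFormula = Sat-reduct (λ ())

  ⇒-mapFormula : ∀ {I J} (A B : Sentence V I) → _⇒_ V A B →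
    (g : I → J) (M : Structure V J) → M ⊨ mapFormula V g A → M ⊨ mapFormula V g B
  ⇒-mapFormula A B A⇒B g M a =
    to (⊨-mapFormula g M B) (⇒-elim A B A⇒B (reduct g M) (from (⊨-mapFormula g M A) a))

  mutual
    mapTerm-id : ∀ {I n} {h : I → I} → h ≗ id → (t : Term V I n) → mapTerm V h t ≡ t
    mapTerm-id h≗id (var x)      = refl
    mapTerm-id h≗id (app i f ts) = cong₂ (λ j us → app j f us) (h≗id i) (mapTerms-id h≗id ts)

    mapTerms-id : ∀ {I n k} {h : I → I} → h ≗ id → (ts : Vec (Term V I n) k) → mapTerms V h ts ≡ ts
    mapTerms-id h≗id []       = refl
    mapTerms-id h≗id (t ∷ ts) = cong₂ _∷_ (mapTerm-id h≗id t) (mapTerms-id h≗id ts)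

  mapFormula-id : ∀ {I n} {h : I → I} → h ≗ id → (φ : Formula V I n) → mapFormula V h φ ≡ φ
  mapFormula-id h≗id (rel i r ts) = cong₂ (λ j us → rel j r us) (h≗id i) (mapTerms-id h≗id ts)
  mapFormula-id h≗id (a ≐ b)      = cong₂ _≐_ (mapTerm-id h≗id a) (mapTerm-id h≗id b)
  mapFormula-id h≗id (¬' φ)       = cong ¬'_ (mapFormula-id h≗id φ)
  mapFormula-id h≗id (φ ∧' ψ)     = cong₂ _∧'_ (mapFormula-id h≗id φ) (mapFormula-id h≗id ψ)
  mapFormula-id h≗id (∀' φ)       = cong ∀'_ (mapFormula-id h≗id φ)

  swapCopy-involutive : ∀ i → swapCopy (swapCopy i) ≡ i
  swapCopy-involutive cur = refl
  swapCopy-involutive nxt = refl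

  ⊨-mapFormula-∘ : ∀ {I J K} (g : J → K) (h : I → J) (M : Structure V K) (φ : Sentence V I) →
    M ⊨ mapFormula V (λ i → g (h i)) φ ⇔ reduct g M ⊨ mapFormula V h φ
  -- reduct h (reduct g M) and reduct (g ∘ h) M coincide definitionally.
  ⊨-mapFormula-∘ g h M φ = mk⇔
    (λ s → to (⊨-mapFormula h (reduct g M) φ) (from (⊨-mapFormula (λ i → g (h i)) M φ) s))
    (λ s → to (⊨-mapFormula (λ i → g (h i)) M φ) (from (⊨-mapFormula h (reduct g M) φ) s))

  ⊨-inverse : ∀ M (τ : Sentence V Copy) → M ⊨ τ → reduct swapCopy M ⊨ inverse V τ
  ⊨-inverse M τ s = to (⊨-mapFormula-∘ swapCopy swapCopy M τ)
    (subst (M ⊨_) (sym (mapFormula-id swapCopy-involutive τ)) s)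

  Inductive : Sentence V Copy → Sentence V ⊤ → Set₁
  Inductive τ φ = _⇒_ V (unprimed V φ ∧' τ) (primed V φ)

  Inductive-elim : ∀ τ φ → Inductive τ φ → ∀ M → M ⊨ unprimed V φ → M ⊨ τ → M ⊨ primed V φ
  Inductive-elim τ φ φ-ind M φ₀ t = ⇒-elim (unprimed V φ ∧' τ) (primed V φ) φ-ind M (φ₀ , t)

  Inductive-intro : ∀ τ φ → (∀ M → M ⊨ unprimed V φ → M ⊨ τ → M ⊨ primed V φ) → Inductive τ φ
  Inductive-intro τ φ step = ⇒-intro (unprimed V φ ∧' τ) (primed V φ) λ M (φ₀ , t) → step M φ₀ t

  Inductive-¬ : ∀ τ φ → Inductive (inverse V τ) φ → Inductive τ (¬' φ)
  Inductive-¬ τ φ φ-ind⁻¹ = Inductive-intro τ (¬' φ) λ M ¬φ₀ t φ₁ →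
    let φ₀' = Inductive-elim (inverse V τ) φ φ-ind⁻¹ (reduct swapCopy M)
                (to (⊨-mapFormula-∘ swapCopy (λ _ → cur) M φ) φ₁) (⊨-inverse M τ t)
    in ¬φ₀ (from (⊨-mapFormula-∘ swapCopy (λ _ → nxt) M φ) φ₀')

  Inductive-∧ : ∀ τ a b φ → _⇒_ V a φ → Inductive τ a →
    Inductive (τ ∧' unprimed V φ ∧' primed V φ) b → Inductive τ (a ∧' b)
  Inductive-∧ τ a b φ a⇒φ a-ind b-ind = Inductive-intro τ (a ∧' b) λ M (a₀ , b₀) t →
    let a₁ = Inductive-elim τ a a-ind M a₀ t
        φ₀ = ⇒-mapFormula a φ a⇒φ (λ _ → cur) M a₀
        φ₁ = ⇒-mapFormula a φ a⇒φ (λ _ → nxt) M a₁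
    in a₁ , Inductive-elim (τ ∧' unprimed V φ ∧' primed V φ) b b-ind M b₀ (t , φ₀ , φ₁)

  module _ (ι : Sentence V ⊤) (τ : Sentence V Copy) where

    Ind-safe : ∀ φ → _⇒_ V ι φ → Inductive τ φ → SafeInductiveInvariant V ⟨ ι , τ , ¬' φ ⟩ φ
    Ind-safe φ ι⇒φ φ-ind = ι⇒φ , φ-ind , ⇒-intro φ (¬' ¬' φ) λ M φ₀ ¬φ₀ → ¬φ₀ φ₀

    Cons-safe : ∀ β φ ψ → SafeInductiveInvariant V ⟨ ι , τ , ¬' φ ⟩ ψ → _⇒_ V φ (¬' β) →
      SafeInductiveInvariant V ⟨ ι , τ , β ⟩ ψ
    Cons-safe β φ ψ (ι⇒ψ , ψ-ind , ψ⇒¬¬φ) φ⇒¬β = ι⇒ψ , ψ-ind , ⇒-intro ψ (¬' β) λ M ψ₀ →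
      ⇒-elim φ (¬' β) φ⇒¬β M (⇒-elim ψ φ (⇒-¬¬-elim ψ φ ψ⇒¬¬φ) M ψ₀)

    Inc-safe : ∀ β φ a b → SafeInductiveInvariant V ⟨ ι , τ , ¬' φ ⟩ a →
      SafeInductiveInvariant V ⟨ ι ∧' φ , τ ∧' unprimed V φ ∧' primed V φ , β ∧' φ ⟩ b →
      SafeInductiveInvariant V ⟨ ι , τ , β ⟩ (a ∧' b)
    Inc-safe β φ a b (ι⇒a , a-ind , a⇒¬¬φ) (ιφ⇒b , b-ind , b⇒¬βφ) =
      (⇒-intro ι (a ∧' b) λ M ι₀ →
        let a₀ = ⇒-elim ι a ι⇒a M ι₀ in a₀ , ⇒-elim (ι ∧' φ) b ιφ⇒b M (ι₀ , φ-of a₀)) ,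
      Inductive-∧ τ a b φ a⇒φ a-ind b-ind ,
      (⇒-intro (a ∧' b) (¬' β) λ M (a₀ , b₀) β₀ →
        ⇒-elim b (¬' (β ∧' φ)) b⇒¬βφ M b₀ (β₀ , φ-of a₀))
      where
        a⇒φ : _⇒_ V a φ
        a⇒φ = ⇒-¬¬-elim a φ a⇒¬¬φ
        φ-of : ∀ {M} → M ⊨ a → M ⊨ φ
        φ-of = ⇒-elim a φ a⇒φ _

    Rev-safe : ∀ β c → SafeInductiveInvariant V ⟨ β , inverse V τ , ι ⟩ c →
      SafeInductiveInvariant V ⟨ ι , τ , β ⟩ (¬' c)
    Rev-safe β c (β⇒c , c-ind , c⇒¬ι) =
      (⇒-intro ι (¬' c) λ M ι₀ c₀ → ⇒-elim c (¬' ι) c⇒¬ι M c₀ ι₀) ,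
      Inductive-¬ τ c c-ind ,
      (⇒-intro (¬' c) (¬' β) λ M ¬c₀ β₀ → ¬c₀ (⇒-elim β c β⇒c M β₀))

  renameAtoms : ∀ {m n} → (Fin m → Fin n) → BoolExpr V m → BoolExpr V n
  renameAtoms f (atom x)   = atom (f x)
  renameAtoms f (neg b)    = neg (renameAtoms f b)
  renameAtoms f (conj b c) = conj (renameAtoms f b) (renameAtoms f c)

  instantiate-renameAtoms : ∀ {m n} (f : Fin m → Fin n) (b : BoolExpr V m)
    (ps : Vec (Sentence V ⊤) m) (qs : Vec (Sentence V ⊤) n) →
    (∀ x → lookup qs (f x) ≡ lookup ps x) →
    instantiate V (renameAtoms f b) qs ≡ instantiate V b ps
  instantiate-renameAtoms f (atom x)   ps qs qs∘f≗ps = qs∘f≗ps x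
  instantiate-renameAtoms f (neg b)    ps qs qs∘f≗ps =
    cong ¬'_ (instantiate-renameAtoms f b ps qs qs∘f≗ps)
  instantiate-renameAtoms f (conj b c) ps qs qs∘f≗ps =
    cong₂ _∧'_ (instantiate-renameAtoms f b ps qs qs∘f≗ps)
               (instantiate-renameAtoms f c ps qs qs∘f≗ps)

  module _ {ℙ : Sentence V ⊤ → Set} where

    Inv⇄-safe : ∀ {Π} (P : FBI V ℙ Π) → SafeInductiveInvariant V Π (Inv⇄ V P)
    Inv⇄-safe (Ind {ι} {τ} {φ} _ ι⇒φ φ-ind) = Ind-safe ι τ φ ι⇒φ φ-ind
    Inv⇄-safe (Cons {ι} {τ} {β} {φ} P φ⇒¬β) = Cons-safe ι τ β φ (Inv⇄ V P) (Inv⇄-safe P) φ⇒¬β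
    Inv⇄-safe (Inc {ι} {τ} {β} {φ} P₁ P₂)   =
      Inc-safe ι τ β φ (Inv⇄ V P₁) (Inv⇄ V P₂) (Inv⇄-safe P₁) (Inv⇄-safe P₂)
    Inv⇄-safe (Rev {ι} {τ} {β} P)           = Rev-safe ι τ β (Inv⇄ V P) (Inv⇄-safe P)

    BoolCombinationOf-atom : ∀ {φ} → ℙ φ → BoolCombinationOf V ℙ 1 φ
    BoolCombinationOf-atom {φ} ℙφ = atom F.zero , φ ∷ [] , ℙφ VAll.∷ VAll.[] , refl

    BoolCombinationOf-¬ : ∀ {n φ} → BoolCombinationOf V ℙ n φ → BoolCombinationOf V ℙ n (¬' φ)
    BoolCombinationOf-¬ (b , ps , ℙps , b[ps]≡φ) = neg b , ps , ℙps , cong ¬'_ b[ps]≡φ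

    BoolCombinationOf-∧ : ∀ {m n φ ψ} → BoolCombinationOf V ℙ m φ → BoolCombinationOf V ℙ n ψ →
      BoolCombinationOf V ℙ (m + n) (φ ∧' ψ)
    BoolCombinationOf-∧ {m} {n} (b , ps , ℙps , b[ps]≡φ) (c , qs , ℙqs , c[qs]≡ψ) =
      conj (renameAtoms (_↑ˡ n) b) (renameAtoms (m ↑ʳ_) c) , ps ++ qs , ++⁺ ℙps ℙqs ,
      cong₂ _∧'_ (trans (instantiate-renameAtoms _ b ps (ps ++ qs) (lookup-++ˡ ps qs)) b[ps]≡φ)
                 (trans (instantiate-renameAtoms _ c qs (ps ++ qs) (lookup-++ʳ ps qs)) c[qs]≡ψ)

    Inv⇄-boolCombination : ∀ {Π} (P : FBI V ℙ Π) → BoolCombinationOf V ℙ (#Ind V P) (Inv⇄ V P)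
    Inv⇄-boolCombination (Ind ℙφ _ _) = BoolCombinationOf-atom ℙφ
    Inv⇄-boolCombination (Cons P _)   = Inv⇄-boolCombination P
    Inv⇄-boolCombination (Inc P₁ P₂)  =
      BoolCombinationOf-∧ (Inv⇄-boolCombination P₁) (Inv⇄-boolCombination P₂)
    Inv⇄-boolCombination (Rev P)      = BoolCombinationOf-¬ (Inv⇄-boolCombination P)

theorem4p13 : (V : Vocabulary) (ℙ : Sentence V ⊤ → Set) {Π : SafetyProblem V}
    (P : FBI V ℙ Π) →
    SafeInductiveInvariant V Π (Inv⇄ V P)
      × BoolCombinationOf V ℙ (#Ind V P) (Inv⇄ V P)
theorem4p13 V ℙ P = Inv⇄-safe V P , Inv⇄-boolCombination V P
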